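{- Let $S$ and $S'$ be states with $S\mapsto S'$ such that every rule applied in passing from $S$ to $S'$ is an Increment rule. Let $n:=n(S)$, $n':=n(S')$, $\ell:=\ell(S)$ (so $\ell(S')=\ell$ and $\sigma(S)=\sigma(S')$). Then for each $i\in[0,\ell]$, $$a_i(S')=\begin{cases} a_i(S)+d_i(n,n') & i\ge 1,\\ a_i(S)-d_i(n,n') & i=0.\end{cases}$$
   Context: A state is a finite tuple of integers $S=(a_\ell,\dots,a_1,a_0)$, $\ell\ge0$; $a_i$ is the $i$-th index (counted from the right starting at 0). The successor $P(S)$: (Overflow) if $a_\ell$ is odd and all other entries even, $P(S)=(0,a_\ell+1,a_{\ell-1},\dots,a_0)$; (Halt) if all entries even and $a_\ell=a_{\ell-1}=0$, the process halts; (Zero) if all entries even and $(a_\ell,a_{\ell-1})\ne(0,0)$, $P(S)=(0,0,a_\ell+1,a_{\ell-1},\dots,a_1,a_0-1)$; (Halve) if $a_0=-1$, $P(S)=(a_\ell,\dots,a_1)$; (Increment) otherwise, with $i$ the smallest index such that $a_i$ is odd, $P(S)=(a_\ell,\dots,a_{i+2},a_{i+1}+1,a_i,\dots,a_1,a_0-1)$. $S\mapsto T$ means $T=P^j(S)$ for some $j\ge0$; the rules applied are those used at $S,\dots,P^{j-1}(S)$. For real $r$, $\langle r\rangle$ denotes the nearest integer to $r$, half-integers rounded up. For a state $S$: $\ell(S)$ is its length minus one; $a_i(S)$ is its $i$-th entry; $\sigma(S)=+1$ if $\sum_i a_i$ is odd and $-1$ if it is even; $n(S)$ is the unique integer $0\le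 n<2^{\ell}$ with $\langle n/2^i\rangle\equiv a_i \pmod 2$ for all $1\le i\le\ell$ (equivalently, $n$ is the number whose binary reflected Gray code is the bit string $(a_\ell\bmod2)\cdots(a_1\bmod 2)$; $a_0$ is not used). For integers $a,b$ and $j\ge0$, $d_j(a,b):=\left|\langle a/2^j\rangle-\langle b/2^j\rangle\right|$. -}

module Defs where

open import Data.Nat as ℕ using (ℕ; zero; suc; _^_)
open import Data.Nat.Properties using (m^n≢0)
open import Data.Integer as ℤ using (ℤ; +_; _+_; _-_; _*_; ∣_∣; 1ℤ; -1ℤ)
open import Data.Integer.DivMod using (_/ℕ_)
open import Data.Fin using (Fin; zero; suc; inject₁; toℕ)
open import Data.Vec using (Vec; lookup; _[_]%=_)
open import Data.Product using (Σ; ∃; _×_)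
open import Relation.Nullary using (¬_)
open import Relation.Binary.PropositionalEquality using (_≡_; _≢_)

Even : ℤ → Set
Even z = ∃ λ k → z ≡ + 2 * k

Odd : ℤ → Set
Odd z = ∃ λ k → z ≡ + 2 * k + 1ℤ

-- A state of length ℓ+1, stored little-endian: lookup S i = a_i(S)
-- (index counted from the right, starting at 0).  ℓ(S) = ℓ.
State : ℕ → Set
State ℓ = Vec ℤ (suc ℓ)

a : ∀ {ℓ} → State ℓ → Fin (suc ℓ) → ℤ
a S i = lookup S i

-- ⟨ x / 2^j ⟩ : nearest integer to x/2^j, half-integers rounded up,
-- i.e. ⌊ x/2^j + 1/2 ⌋ = ⌊ (2x + 2^j) / 2^(j+1) ⌋ (floor division).
roundPow2 : ℤ → ℕ → ℤ
roundPow2 x j = ((+ 2 * x) + + (2 ^ j)) /ℕ (2 ^ suc j)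
  where instance _ = m^n≢0 2 (suc j)

d : ℕ → ℤ → ℤ → ℤ
d j x y = + ∣ roundPow2 x j - roundPow2 y j ∣

IsN : ∀ {ℓ} → State ℓ → ℕ → Set
IsN {ℓ} S n = (n ℕ.< 2 ^ ℓ)
  × (∀ (i : Fin ℓ) → Even (roundPow2 (+ n) (suc (toℕ i)) - a S (suc i)))

OverflowCond : ∀ {ℓ} → State ℓ → Set
OverflowCond {ℓ} S = Odd (a S (Data.Fin.fromℕ ℓ))
  × (∀ (i : Fin ℓ) → Even (a S (inject₁ i)))

-- All entries even (condition of the Halt and Zero rules).
AllEven : ∀ {ℓ} → State ℓ → Set
AllEven S = ∀ i → Even (a S i)

-- The Increment rule applies to S: none of Overflow, Halt, Zero, Halve applies.
IncrementApplies : ∀ {ℓ} → State ℓ → Set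
IncrementApplies S = ¬ OverflowCond S × ¬ AllEven S × a S zero ≢ -1ℤ

SmallestOdd : ∀ {ℓ} → State ℓ → Fin (suc ℓ) → Set
SmallestOdd S i = Odd (a S i) × (∀ j → toℕ j ℕ.< toℕ i → Even (a S j))

-- One step S → T by the Increment rule: with i the smallest odd index
-- (necessarily i < ℓ), T = (a_ℓ,…,a_{i+1}+1,a_i,…,a_1,a_0-1).
IncStep : ∀ {ℓ} → State ℓ → State ℓ → Set
IncStep {ℓ} S T = IncrementApplies S
  × Σ (Fin ℓ) λ i → SmallestOdd S (inject₁ i)
      × T ≡ ((S [ suc i ]%= (λ x → x + 1ℤ)) [ zero ]%= (λ x → x - 1ℤ))

{-# OPTIONS --safe #-}

-- Write ⟨ m /2^ j ⟩ for the nearest integer to m/2^j.  If n(S) = m then a_j ≡ ⟨m/2^j⟩ (mod 2) for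
-- j ≥ 1, so the smallest odd index t of S is the smallest odd term of x, ⟨m/2⟩, ⟨m/4⟩, … for any
-- x ≡ a_0.  When a_0 + m is odd take x = m + 1: then t + 1 is the Gray-code bit flipped between m
-- and m + 1, i.e. ⟨·/2^(t+1)⟩ grows by one from m to m + 1 and every other ⟨·/2^j⟩, j ≥ 1, stays
-- put.  When a_0 + m is even take x = m: the same holds between m − 1 and m.  So an Increment step
-- moves n by one in a direction that never changes, and along the run the quantities a_0 + n and
-- ⟨n/2^j⟩ − a_j (n increasing), resp. n − a_0 and ⟨n/2^j⟩ + a_j (n decreasing), are conserved.
-- Since ⟨·/2^j⟩ is monotone, conservation is exactly the claimed formula.

module Submission where

open import Defs
open import Data.Nat
  using (ℕ; zero; suc; _^_; _≤_; _<_; z≤n; s≤s; z<s; ⌊_/2⌋; ⌈_/2⌉)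
  renaming (_+_ to _ℕ+_; _*_ to _ℕ*_)
open import Data.Nat using () renaming (suc to 1+)
open import Data.Nat.Properties
  using ( m^n≢0; +-comm; *-comm; +-suc; +-identityʳ; *-distribˡ-+; ≤-refl; ≤-trans; <⇒≤
        ; <-trans; n≤1+n; n<1+n; >⇒≢; n<1⇒n≡0; m*n≡1⇒m≡1; +-monoˡ-<; +-cancelʳ-<
        ; ⌊n/2⌋-mono; ⌈n/2⌉-mono; n≡⌊n+n/2⌋; n≡⌈n+n/2⌉ )
open import Data.Nat.DivMod
  using ( _/_; m/n≡1+[m∸n]/n; m/n/o≡m/[n*o]; +-distrib-/-∣ʳ; m*n/n≡m; m*n/m*o≡n/o
        ; m<n⇒m/n≡0; m/n≡0⇒m<n )
open import Data.Nat.Divisibility using (m∣m*n)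
open import Data.Integer using (ℤ; +_; _+_; _-_; -_; _*_; ∣_∣; 1ℤ; -1ℤ; +≤+)
open import Data.Integer.Properties as ℤ
  using (pos-*; abs-*; +-minus-telescope; ∣-∣-≤; ∣i-j∣≡∣j-i∣)
open import Data.Integer.DivMod using (_/ℕ_; _%ℕ_; n%ℕd<d; a≡a%ℕn+[a/ℕn]*n)
open import Data.Integer.Tactic.RingSolver using (solve-∀)
open import Data.Fin using (Fin; zero; suc; toℕ; inject₁; fromℕ<; _≟_)
open import Data.Fin.Properties using (toℕ-inject₁; toℕ-fromℕ<; toℕ<n; toℕ-injective)
open import Data.Vec using (Vec; _∷_; lookup; _[_]%=_)
open import Data.Vec.Properties using (lookup∘updateAt; lookup∘updateAt′)
open import Data.Product using (∃; _×_; _,_; proj₁; proj₂)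
open import Data.Sum using (_⊎_; inj₁; inj₂)
open import Data.Empty using (⊥-elim)
open import Function using (_∘_)
open import Relation.Nullary using (¬_; yes; no)
open import Relation.Binary.PropositionalEquality
open import Relation.Binary.Construct.Closure.ReflexiveTransitive using (Star; ε; _◅_)

-- Parity of integers

even-or-odd : ∀ x → Even x ⊎ Odd x
even-or-odd x with x %ℕ 2 | n%ℕd<d x 2 | a≡a%ℕn+[a/ℕn]*n x 2
... | 0 | _ | x≡2q = inj₁ (x /ℕ 2 , trans x≡2q (double (x /ℕ 2)))
  where
  double : ∀ q → + 0 + q * + 2 ≡ + 2 * q
  double = solve-∀
... | 1 | _ | x≡2q+1 = inj₂ (x /ℕ 2 , trans x≡2q+1 (double+1 (x /ℕ 2)))
  where
  double+1 : ∀ q → + 1 + q * + 2 ≡ + 2 * q + 1ℤ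
  double+1 = solve-∀
... | suc (suc _) | s≤s (s≤s ()) | _

even⇒¬odd : ∀ {x} → Even x → ¬ Odd x
even⇒¬odd {x} (k , x≡2k) (l , x≡2l+1)
  with m*n≡1⇒m≡1 2 ∣ k - l ∣ (trans (sym (abs-* (+ 2) (k - l))) (cong ∣_∣ 2[k-l]≡1))
  where
  open ≡-Reasoning
  distrib : ∀ k l → + 2 * (k - l) ≡ + 2 * k - + 2 * l
  distrib = solve-∀
  cancel : ∀ y → y + 1ℤ - y ≡ 1ℤ
  cancel = solve-∀
  2[k-l]≡1 : + 2 * (k - l) ≡ 1ℤ
  2[k-l]≡1 = begin
    + 2 * (k - l)           ≡⟨ distrib k l ⟩
    + 2 * k - + 2 * l       ≡⟨ cong (λ z → z - + 2 * l) (trans (sym x≡2k) x≡2l+1) ⟩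
    + 2 * l + 1ℤ - + 2 * l  ≡⟨ cancel (+ 2 * l) ⟩
    1ℤ                      ∎
... | ()

even+even : ∀ {x y} → Even x → Even y → Even (x + y)
even+even (k , refl) (l , refl) = k + l , distrib k l
  where
  distrib : ∀ k l → + 2 * k + + 2 * l ≡ + 2 * (k + l)
  distrib = solve-∀

even+odd : ∀ {x y} → Even x → Odd y → Odd (x + y)
even+odd (k , refl) (l , refl) = k + l , distrib k l
  where
  distrib : ∀ k l → + 2 * k + (+ 2 * l + 1ℤ) ≡ + 2 * (k + l) + 1ℤ
  distrib = solve-∀

infix 4 _≡₂_

record _≡₂_ (x y : ℤ) : Set where
  constructor even-diff
  field difference-even : Even (x - y)

open _≡₂_

≡₂-sym : ∀ {x y} → x ≡₂ y → y ≡₂ x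
≡₂-sym {x} {y} (even-diff (k , x-y≡2k)) = even-diff (- k , (begin
  y - x           ≡⟨ flip x y ⟩
  - (x - y)       ≡⟨ cong -_ x-y≡2k ⟩
  - (+ 2 * k)     ≡⟨ neg-double k ⟩
  + 2 * - k       ∎))
  where
  open ≡-Reasoning
  flip : ∀ x y → y - x ≡ - (x - y)
  flip = solve-∀
  neg-double : ∀ k → - (+ 2 * k) ≡ + 2 * - k
  neg-double = solve-∀

≡₂-trans : ∀ {x y z} → x ≡₂ y → y ≡₂ z → x ≡₂ z
≡₂-trans {x} {y} {z} (even-diff x-y) (even-diff y-z) =
  even-diff (subst Even (+-minus-telescope x y z) (even+even x-y y-z))

even-resp : ∀ {x y} → x ≡₂ y → Even y → Even x
even-resp {x} {y} (even-diff x-y) even-y = subst Even (minus-plus x y) (even+even x-y even-y)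
  where
  minus-plus : ∀ x y → x - y + y ≡ x
  minus-plus = solve-∀

odd-resp : ∀ {x y} → x ≡₂ y → Odd y → Odd x
odd-resp {x} {y} (even-diff x-y) odd-y = subst Odd (minus-plus x y) (even+odd x-y odd-y)
  where
  minus-plus : ∀ x y → x - y + y ≡ x
  minus-plus = solve-∀

≡₂⇒even-sum : ∀ {x y} → x ≡₂ y → Even (x + y)
≡₂⇒even-sum {x} {y} (even-diff x-y) = subst Even (regroup x y) (even+even x-y (y , refl))
  where
  regroup : ∀ x y → x - y + + 2 * y ≡ x + y
  regroup = solve-∀

even-sum⇒≡₂ : ∀ {x y} → Even (x + y) → x ≡₂ y
even-sum⇒≡₂ {x} {y} x+y = even-diff (subst Even (regroup x y) (even+even x+y (- y , refl)))
  where
  regroup : ∀ x y → x + y + + 2 * - y ≡ x - y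
  regroup = solve-∀

odd-diff⇒1+≡₂ : ∀ {x y} → Odd (x - y) → 1ℤ + x ≡₂ y
odd-diff⇒1+≡₂ {x} {y} (k , x-y≡2k+1) = even-diff (k + 1ℤ , (begin
  1ℤ + x - y          ≡⟨ assoc x y ⟩
  1ℤ + (x - y)        ≡⟨ cong (λ z → 1ℤ + z) x-y≡2k+1 ⟩
  1ℤ + (+ 2 * k + 1ℤ) ≡⟨ double-suc k ⟩
  + 2 * (k + 1ℤ)      ∎))
  where
  open ≡-Reasoning
  assoc : ∀ x y → 1ℤ + x - y ≡ 1ℤ + (x - y)
  assoc = solve-∀
  double-suc : ∀ k → 1ℤ + (+ 2 * k + 1ℤ) ≡ + 2 * (k + 1ℤ)
  double-suc = solve-∀

¬x≡₂1+x : ∀ x → ¬ (x ≡₂ 1ℤ + x)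
¬x≡₂1+x x (even-diff x-[1+x]) = even⇒¬odd (subst Even (difference x) x-[1+x]) (-1ℤ , refl)
  where
  difference : ∀ x → x - (1ℤ + x) ≡ -1ℤ
  difference = solve-∀

data ParityView : ℕ → Set where
  even : ∀ h → ParityView (h ℕ+ h)
  odd  : ∀ h → ParityView (suc (h ℕ+ h))

parityView : ∀ m → ParityView m
parityView zero = even zero
parityView (suc m) with parityView m
... | even h = odd h
... | odd h  = subst ParityView (cong suc (+-suc h h)) (even (suc h))

even-double : ∀ h → Even (+ (h ℕ+ h))
even-double h = + h , trans (cong (λ z → + (h ℕ+ z)) (sym (+-identityʳ h))) (pos-* 2 h)

odd-double : ∀ h → Odd (+ suc (h ℕ+ h))
odd-double h = + h , trans (cong (λ z → 1ℤ + z) (proj₂ (even-double h))) (ℤ.+-comm 1ℤ (+ 2 * + h))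

-- Rounding to a power of two

-- Halving commutes with rounding only from j = 1 on: ⟨m/2^(j+1)⟩ = ⟨⌊m/2⌋/2^j⟩ for j ≥ 1,
-- whereas ⟨m/2⟩ = ⌈m/2⌉.
⟨_/2^_⟩ : ℕ → ℕ → ℕ
⟨ m /2^ zero ⟩        = m
⟨ m /2^ suc zero ⟩    = ⌈ m /2⌉
⟨ m /2^ suc (suc j) ⟩ = ⟨ ⌊ m /2⌋ /2^ suc j ⟩

⌊n/2⌋≡n/2 : ∀ n → ⌊ n /2⌋ ≡ n / 2
⌊n/2⌋≡n/2 zero          = refl
⌊n/2⌋≡n/2 (suc zero)    = refl
⌊n/2⌋≡n/2 (suc (suc n)) =
  trans (cong suc (⌊n/2⌋≡n/2 n)) (sym (m/n≡1+[m∸n]/n {suc (suc n)} {2} (s≤s (s≤s z≤n))))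

[m+2n]/2≡⌊m/2⌋+n : ∀ m n → (m ℕ+ 2 ℕ* n) / 2 ≡ ⌊ m /2⌋ ℕ+ n
[m+2n]/2≡⌊m/2⌋+n m n = begin
  (m ℕ+ 2 ℕ* n) / 2     ≡⟨ +-distrib-/-∣ʳ m (m∣m*n n) ⟩
  m / 2 ℕ+ 2 ℕ* n / 2   ≡⟨ cong₂ _ℕ+_ (sym (⌊n/2⌋≡n/2 m)) (trans (cong (_/ 2) (*-comm 2 n)) (m*n/n≡m n 2)) ⟩
  ⌊ m /2⌋ ℕ+ n          ∎
  where open ≡-Reasoning

⟨/2^suc⟩≡/ : ∀ k m → let instance _ = m^n≢0 2 (suc k) in
             ⟨ m /2^ suc k ⟩ ≡ (m ℕ+ 2 ^ k) / 2 ^ suc k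
⟨/2^suc⟩≡/ zero    m = trans (⌊n/2⌋≡n/2 (suc m)) (cong (_/ 2) (+-comm 1 m))
⟨/2^suc⟩≡/ (suc k) m = begin
  ⟨ ⌊ m /2⌋ /2^ suc k ⟩                   ≡⟨ ⟨/2^suc⟩≡/ k ⌊ m /2⌋ ⟩
  (⌊ m /2⌋ ℕ+ 2 ^ k) / 2 ^ suc k          ≡⟨ cong (_/ 2 ^ suc k) ([m+2n]/2≡⌊m/2⌋+n m (2 ^ k)) ⟨
  (m ℕ+ 2 ^ suc k) / 2 / 2 ^ suc k        ≡⟨ m/n/o≡m/[n*o] (m ℕ+ 2 ^ suc k) 2 (2 ^ suc k) ⟩
  (m ℕ+ 2 ^ suc k) / 2 ^ suc (suc k)      ∎
  where
  open ≡-Reasoning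
  instance _ = m^n≢0 2 (suc k)
           _ = m^n≢0 2 (suc (suc k))

roundPow2-pos : ∀ m j → roundPow2 (+ m) j ≡ + ⟨ m /2^ j ⟩
roundPow2-pos m j rewrite sym (pos-* 2 m) = cong +_ (unsigned j)
  where
  unsigned : ∀ j → let instance _ = m^n≢0 2 (suc j) in
             (2 ℕ* m ℕ+ 2 ^ j) / 2 ^ suc j ≡ ⟨ m /2^ j ⟩
  unsigned zero    = trans (cong (_/ 2) (+-comm (2 ℕ* m) 1)) ([m+2n]/2≡⌊m/2⌋+n 1 m)
  unsigned (suc k) = begin
    (2 ℕ* m ℕ+ 2 ℕ* 2 ^ k) / 2 ^ suc (suc k)  ≡⟨ cong (_/ 2 ^ suc (suc k)) (sym (*-distribˡ-+ 2 m (2 ^ k))) ⟩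
    2 ℕ* (m ℕ+ 2 ^ k) / (2 ℕ* 2 ^ suc k)      ≡⟨ m*n/m*o≡n/o 2 (m ℕ+ 2 ^ k) (2 ^ suc k) ⟩
    (m ℕ+ 2 ^ k) / 2 ^ suc k                  ≡⟨ ⟨/2^suc⟩≡/ k m ⟨
    ⟨ m /2^ suc k ⟩                           ∎
    where
    open ≡-Reasoning
    instance _ = m^n≢0 2 (suc k)
             _ = m^n≢0 2 (suc (suc k))

⟨/2^⟩-mono : ∀ j {m n} → m ≤ n → ⟨ m /2^ j ⟩ ≤ ⟨ n /2^ j ⟩
⟨/2^⟩-mono zero          m≤n = m≤n
⟨/2^⟩-mono (suc zero)    m≤n = ⌈n/2⌉-mono m≤n
⟨/2^⟩-mono (suc (suc j)) m≤n = ⟨/2^⟩-mono (suc j) (⌊n/2⌋-mono m≤n)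

n+n≡2*n : ∀ n → n ℕ+ n ≡ 2 ℕ* n
n+n≡2*n n = cong (n ℕ+_) (sym (+-identityʳ n))

<⇒⟨/2^suc⟩≡0 : ∀ {m} k → m < 2 ^ k → ⟨ m /2^ suc k ⟩ ≡ 0
<⇒⟨/2^suc⟩≡0 {m} k m<2^k =
  trans (⟨/2^suc⟩≡/ k m)
        (m<n⇒m/n≡0 (subst (m ℕ+ 2 ^ k <_) (n+n≡2*n (2 ^ k)) (+-monoˡ-< (2 ^ k) m<2^k)))
  where instance _ = m^n≢0 2 (suc k)

⟨/2^suc⟩≡0⇒< : ∀ {m} k → ⟨ m /2^ suc k ⟩ ≡ 0 → m < 2 ^ k
⟨/2^suc⟩≡0⇒< {m} k ⟨m/2^1+k⟩≡0 = +-cancelʳ-< (2 ^ k) m (2 ^ k)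
  (subst (m ℕ+ 2 ^ k <_) (sym (n+n≡2*n (2 ^ k)))
         (m/n≡0⇒m<n (trans (sym (⟨/2^suc⟩≡/ k m)) ⟨m/2^1+k⟩≡0)))
  where instance _ = m^n≢0 2 (suc k)

d-≤ : ∀ j {m n} → m ≤ n → d j (+ m) (+ n) ≡ + ⟨ n /2^ j ⟩ - + ⟨ m /2^ j ⟩
d-≤ j {m} {n} m≤n rewrite roundPow2-pos m j | roundPow2-pos n j = ∣-∣-≤ (+≤+ (⟨/2^⟩-mono j m≤n))

d-≥ : ∀ j {m n} → n ≤ m → d j (+ m) (+ n) ≡ + ⟨ m /2^ j ⟩ - + ⟨ n /2^ j ⟩
d-≥ j {m} {n} n≤m = trans (cong +_ (∣i-j∣≡∣j-i∣ (roundPow2 (+ m) j) (roundPow2 (+ n) j))) (d-≤ j n≤m)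

-- Gray code steps

LowestOdd : (ℕ → ℕ) → ℕ → Set
LowestOdd f t = (∀ j → j < t → Even (+ f j)) × Odd (+ f t)

roundings : ℕ → ℕ → ℕ → ℕ
roundings x m zero    = x
roundings x m (suc j) = ⟨ m /2^ suc j ⟩

GrayStep : ℕ → ℕ → Set
GrayStep m t = ⟨ suc m /2^ suc t ⟩ ≡ suc ⟨ m /2^ suc t ⟩
             × (∀ k → k ≢ t → ⟨ suc m /2^ suc k ⟩ ≡ ⟨ m /2^ suc k ⟩)

⌊h+h/2⌋≡⌈h+h/2⌉ : ∀ h → ⌊ h ℕ+ h /2⌋ ≡ ⌈ h ℕ+ h /2⌉
⌊h+h/2⌋≡⌈h+h/2⌉ h = trans (sym (n≡⌊n+n/2⌋ h)) (n≡⌈n+n/2⌉ h)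

grayStep-double : ∀ h → GrayStep (h ℕ+ h) 0
grayStep-double h = cong suc (⌊h+h/2⌋≡⌈h+h/2⌉ h) , unchanged
  where
  unchanged : ∀ k → k ≢ 0 → ⟨ suc (h ℕ+ h) /2^ suc k ⟩ ≡ ⟨ h ℕ+ h /2^ suc k ⟩
  unchanged zero    k≢0 = ⊥-elim (k≢0 refl)
  unchanged (suc k) _   = cong ⟨_/2^ suc k ⟩ (sym (⌊h+h/2⌋≡⌈h+h/2⌉ h))

grayStep-shift : ∀ {h t} → GrayStep h t → GrayStep (suc (h ℕ+ h)) (suc t)
grayStep-shift {h} {t} (changed , unchanged) = changed′ , unchanged′
  where
  changed′ : ⟨ suc ⌊ h ℕ+ h /2⌋ /2^ suc t ⟩ ≡ suc ⟨ ⌈ h ℕ+ h /2⌉ /2^ suc t ⟩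
  changed′ rewrite sym (n≡⌊n+n/2⌋ h) | sym (n≡⌈n+n/2⌉ h) = changed
  unchanged′ : ∀ k → k ≢ suc t → ⟨ suc (suc (h ℕ+ h)) /2^ suc k ⟩ ≡ ⟨ suc (h ℕ+ h) /2^ suc k ⟩
  unchanged′ zero    _     = cong suc (sym (⌊h+h/2⌋≡⌈h+h/2⌉ h))
  unchanged′ (suc k) k≢1+t rewrite sym (n≡⌊n+n/2⌋ h) | sym (n≡⌈n+n/2⌉ h) =
    unchanged k (k≢1+t ∘ cong suc)

lowestOdd-tail : ∀ {x m t} → LowestOdd (roundings x m) (suc t) → LowestOdd (roundings ⌈ m /2⌉ ⌊ m /2⌋) t
lowestOdd-tail {x} {m} {t} (evens , oddₜ) =
  (λ j j<t → subst (λ z → Even (+ z)) (shift j) (evens (suc j) (s≤s j<t))) ,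
  subst (λ z → Odd (+ z)) (shift t) oddₜ
  where
  shift : ∀ j → roundings x m (suc j) ≡ roundings ⌈ m /2⌉ ⌊ m /2⌋ j
  shift zero    = refl
  shift (suc j) = refl

grayStep-up : ∀ t m → LowestOdd (roundings (suc m) m) t → GrayStep m t
grayStep-up zero m (_ , odd₀) with parityView m
... | even h = grayStep-double h
... | odd h  = ⊥-elim (even⇒¬odd (subst (λ z → Even (+ z)) (cong suc (+-suc h h)) (even-double (suc h))) odd₀)
grayStep-up (suc t) m lowest@(evens , _) with parityView m
... | even h = ⊥-elim (even⇒¬odd (evens 0 z<s) (odd-double h))
... | odd h  = grayStep-shift (grayStep-up t h (subst₂ (λ x y → LowestOdd (roundings x y) t)
                 (cong suc (sym (n≡⌊n+n/2⌋ h))) (sym (n≡⌈n+n/2⌉ h)) (lowestOdd-tail lowest)))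

grayStep-down : ∀ t m → LowestOdd (roundings m m) t → ∃ λ c → m ≡ suc c × GrayStep c t
grayStep-down zero m (_ , odd₀) with parityView m
... | even h = ⊥-elim (even⇒¬odd (even-double h) odd₀)
... | odd h  = h ℕ+ h , refl , grayStep-double h
grayStep-down (suc t) m lowest@(evens , _) with parityView m
... | odd h  = ⊥-elim (even⇒¬odd (evens 0 z<s) (odd-double h))
... | even h with grayStep-down t h (subst₂ (λ x y → LowestOdd (roundings x y) t)
                   (sym (n≡⌈n+n/2⌉ h)) (sym (n≡⌊n+n/2⌋ h)) (lowestOdd-tail lowest))
...   | c , refl , step = suc (c ℕ+ c) , cong suc (+-suc c c) , grayStep-shift step

grayStep-bound : ∀ {m t ℓ} → GrayStep m t → t < ℓ → m < 2 ^ ℓ → suc m < 2 ^ ℓ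
grayStep-bound {ℓ = ℓ} (_ , unchanged) t<ℓ m<2^ℓ =
  ⟨/2^suc⟩≡0⇒< ℓ (trans (unchanged ℓ (>⇒≢ t<ℓ)) (<⇒⟨/2^suc⟩≡0 ℓ m<2^ℓ))

⟨/2^⟩-injective : ∀ ℓ {x y} → x < 2 ^ ℓ → y < 2 ^ ℓ →
                  (∀ (k : Fin ℓ) → + ⟨ x /2^ suc (toℕ k) ⟩ ≡₂ + ⟨ y /2^ suc (toℕ k) ⟩) → x ≡ y
⟨/2^⟩-injective zero    x<1 y<1 _ = trans (n<1⇒n≡0 x<1) (sym (n<1⇒n≡0 y<1))
⟨/2^⟩-injective (suc ℓ) {x} {y} x<2^1+ℓ y<2^1+ℓ same =
  combine (parityView x) (parityView y)
    (⟨/2^⟩-injective ℓ (halve x<2^1+ℓ) (halve y<2^1+ℓ) (λ k → same (suc k))) (same zero)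
  where
  halve : ∀ {z} → z < 2 ^ suc ℓ → ⌊ z /2⌋ < 2 ^ ℓ
  halve z<2^1+ℓ = ⟨/2^suc⟩≡0⇒< ℓ (<⇒⟨/2^suc⟩≡0 (suc ℓ) z<2^1+ℓ)
  combine : ∀ {x y} → ParityView x → ParityView y → ⌊ x /2⌋ ≡ ⌊ y /2⌋ → + ⌈ x /2⌉ ≡₂ + ⌈ y /2⌉ → x ≡ y
  combine (even h) (even h′) eq _ rewrite sym (n≡⌊n+n/2⌋ h) | sym (n≡⌊n+n/2⌋ h′) | eq = refl
  combine (odd h)  (odd h′)  eq _ rewrite sym (n≡⌈n+n/2⌉ h) | sym (n≡⌈n+n/2⌉ h′) | eq = refl
  combine (even h) (odd h′)  eq p
    rewrite sym (n≡⌊n+n/2⌋ h) | sym (n≡⌈n+n/2⌉ h) | sym (n≡⌈n+n/2⌉ h′) | sym (n≡⌊n+n/2⌋ h′) | eq =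
    ⊥-elim (¬x≡₂1+x (+ h′) p)
  combine (odd h)  (even h′) eq p
    rewrite sym (n≡⌊n+n/2⌋ h) | sym (n≡⌈n+n/2⌉ h) | sym (n≡⌈n+n/2⌉ h′) | sym (n≡⌊n+n/2⌋ h′) | eq =
    ⊥-elim (¬x≡₂1+x (+ h′) (≡₂-sym p))

x+u≡y+v⇒y≡x-[v-u] : ∀ x y u v → x + u ≡ y + v → y ≡ x - (v - u)
x+u≡y+v⇒y≡x-[v-u] x y u v e = trans (add-sub y v) (trans (cong (λ z → z - v) (sym e)) (regroup x u v))
  where
  add-sub : ∀ y v → y ≡ y + v - v
  add-sub = solve-∀
  regroup : ∀ x u v → x + u - v ≡ x - (v - u)
  regroup = solve-∀

u+x≡v+y⇒y≡x+[u-v] : ∀ x y u v → u + x ≡ v + y → y ≡ x + (u - v)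
u+x≡v+y⇒y≡x+[u-v] x y u v e = trans (add-sub y v) (trans (cong (λ z → z - v) (sym e)) (regroup x u v))
  where
  add-sub : ∀ y v → y ≡ v + y - v
  add-sub = solve-∀
  regroup : ∀ x u v → u + x - v ≡ x + (u - v)
  regroup = solve-∀

u-x≡v-y⇒y≡x+[v-u] : ∀ x y u v → u - x ≡ v - y → y ≡ x + (v - u)
u-x≡v-y⇒y≡x+[v-u] x y u v e = trans (sub-sub y v) (trans (cong (λ z → v - z) (sym e)) (regroup x u v))
  where
  sub-sub : ∀ y v → y ≡ v - (v - y)
  sub-sub = solve-∀
  regroup : ∀ x u v → v - (u - x) ≡ x + (v - u)
  regroup = solve-∀

u-x≡v-y⇒y≡x-[u-v] : ∀ x y u v → u - x ≡ v - y → y ≡ x - (u - v)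
u-x≡v-y⇒y≡x-[u-v] x y u v e = trans (u-x≡v-y⇒y≡x+[v-u] x y u v e) (regroup x u v)
  where
  regroup : ∀ x u v → x + (v - u) ≡ x - (u - v)
  regroup = solve-∀

module _ {ℓ : ℕ} where

  isN-parity : ∀ (S : State ℓ) {m} → IsN S m → ∀ k → + ⟨ m /2^ suc (toℕ k) ⟩ ≡₂ a S (suc k)
  isN-parity S {m} (_ , parities) k =
    even-diff (subst (λ r → Even (r - a S (suc k))) (roundPow2-pos m (suc (toℕ k))) (parities k))

  isN-intro : ∀ (S : State ℓ) {m} → m < 2 ^ ℓ →
              (∀ k → + ⟨ m /2^ suc (toℕ k) ⟩ ≡₂ a S (suc k)) → IsN S m
  isN-intro S {m} m<2^ℓ parities = m<2^ℓ , λ k →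
    subst (λ r → Even (r - a S (suc k))) (sym (roundPow2-pos m (suc (toℕ k)))) (difference-even (parities k))

  isN-unique : ∀ (S : State ℓ) {m n} → IsN S m → IsN S n → m ≡ n
  isN-unique S isN-m@(m<2^ℓ , _) isN-n@(n<2^ℓ , _) =
    ⟨/2^⟩-injective ℓ m<2^ℓ n<2^ℓ λ k →
      ≡₂-trans (isN-parity S isN-m k) (≡₂-sym (isN-parity S isN-n k))

  Agrees : State ℓ → (ℕ → ℕ) → Set
  Agrees S f = ∀ j → + f (toℕ j) ≡₂ a S j

  isN⇒agrees : ∀ (S : State ℓ) {m x} → IsN S m → + x ≡₂ a S zero → Agrees S (roundings x m)
  isN⇒agrees S _   x≡₂a₀ zero    = x≡₂a₀
  isN⇒agrees S isN _     (suc k) = isN-parity S isN k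

  smallestOdd⇒lowestOdd : ∀ (S : State ℓ) {f j} → Agrees S f → SmallestOdd S j → LowestOdd f (toℕ j)
  smallestOdd⇒lowestOdd S {f} {j} agrees (oddⱼ , evens) = below , odd-resp (agrees j) oddⱼ
    where
    below : ∀ k → k < toℕ j → Even (+ f k)
    below k k<j = subst (λ i → Even (+ f i)) (toℕ-fromℕ< k<1+ℓ)
      (even-resp (agrees (fromℕ< k<1+ℓ)) (evens _ (subst (_< toℕ j) (sym (toℕ-fromℕ< k<1+ℓ)) k<j)))
      where
      k<1+ℓ : k < suc ℓ
      k<1+ℓ = <-trans k<j (toℕ<n j)

  lowestOdd-roundings : ∀ (S : State ℓ) {m x i} → IsN S m → + x ≡₂ a S zero → SmallestOdd S (inject₁ i) →
                        LowestOdd (roundings x m) (toℕ i)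
  lowestOdd-roundings S {i = i} isN x≡₂a₀ smallest =
    subst (LowestOdd _) (toℕ-inject₁ i) (smallestOdd⇒lowestOdd S (isN⇒agrees S isN x≡₂a₀) smallest)

  incremented-entries : ∀ {c} (xs : Vec ℤ ℓ) i → GrayStep c (toℕ i) → ∀ k →
    lookup (xs [ i ]%= (λ x → x + 1ℤ)) k
      ≡ lookup xs k + (+ ⟨ suc c /2^ suc (toℕ k) ⟩ - + ⟨ c /2^ suc (toℕ k) ⟩)
  incremented-entries {c} xs i (changed , unchanged) k with k ≟ i
  ... | yes refl rewrite changed =
    trans (lookup∘updateAt k xs) (plus-one (lookup xs k) (+ ⟨ c /2^ suc (toℕ k) ⟩))
    where
    plus-one : ∀ x y → x + 1ℤ ≡ x + ((1ℤ + y) - y)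
    plus-one = solve-∀
  ... | no k≢i rewrite unchanged (toℕ k) (k≢i ∘ toℕ-injective) =
    trans (lookup∘updateAt′ k i k≢i xs) (plus-zero (lookup xs k) (+ ⟨ c /2^ suc (toℕ k) ⟩))
    where
    plus-zero : ∀ x y → x ≡ x + (y - y)
    plus-zero = solve-∀

  upCharge : State ℓ → ℕ → Fin (suc ℓ) → ℤ
  upCharge S m zero    = a S zero + + m
  upCharge S m (suc k) = + ⟨ m /2^ suc (toℕ k) ⟩ - a S (suc k)

  downCharge : State ℓ → ℕ → Fin (suc ℓ) → ℤ
  downCharge S m zero    = + m - a S zero
  downCharge S m (suc k) = + ⟨ m /2^ suc (toℕ k) ⟩ + a S (suc k)

  up-step : ∀ {S T : State ℓ} {m} → IncStep S T → IsN S m → + suc m ≡₂ a S zero →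
            IsN T (suc m) × + suc (suc m) ≡₂ a T zero × upCharge S m ≗ upCharge T (suc m)
  up-step {x ∷ xs} {T} {m} (_ , i , smallest , refl) isN heading =
    isN-intro T (grayStep-bound step (toℕ<n i) (proj₁ isN)) parities , heading′ , conserved
    where
    step : GrayStep m (toℕ i)
    step = grayStep-up (toℕ i) m (lowestOdd-roundings (x ∷ xs) isN heading smallest)
    conserved : upCharge (x ∷ xs) m ≗ upCharge T (suc m)
    conserved zero    = shift x (+ m)
      where
      shift : ∀ x m → x + m ≡ x - 1ℤ + (1ℤ + m)
      shift = solve-∀
    conserved (suc k) rewrite incremented-entries xs i step k =
      shift (lookup xs k) (+ ⟨ suc m /2^ suc (toℕ k) ⟩) (+ ⟨ m /2^ suc (toℕ k) ⟩)
      where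
      shift : ∀ x s c → c - x ≡ s - (x + (s - c))
      shift = solve-∀
    parities : ∀ k → + ⟨ suc m /2^ suc (toℕ k) ⟩ ≡₂ a T (suc k)
    parities k = even-diff (subst Even (conserved (suc k)) (difference-even (isN-parity (x ∷ xs) isN k)))
    heading′ : + suc (suc m) ≡₂ x - 1ℤ
    heading′ = even-diff (subst Even (plus-two (+ m) x) (even+even (difference-even heading) (1ℤ , refl)))
      where
      plus-two : ∀ m x → 1ℤ + m - x + + 2 * 1ℤ ≡ 1ℤ + (1ℤ + m) - (x - 1ℤ)
      plus-two = solve-∀

  down-step : ∀ {S T : State ℓ} {m} → IncStep S T → IsN S m → + m ≡₂ a S zero →
              ∃ λ c → m ≡ suc c × IsN T c × + c ≡₂ a T zero × downCharge S m ≗ downCharge T c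
  down-step {x ∷ xs} {T} {m} (_ , i , smallest , refl) isN heading
    with grayStep-down (toℕ i) m (lowestOdd-roundings (x ∷ xs) isN heading smallest)
  ... | c , refl , step =
    c , refl , isN-intro T (<-trans (n<1+n c) (proj₁ isN)) parities ,
    even-diff (subst Even (conserved zero) (difference-even heading)) , conserved
    where
    conserved : downCharge (x ∷ xs) (suc c) ≗ downCharge T c
    conserved zero    = shift x (+ c)
      where
      shift : ∀ x c → 1ℤ + c - x ≡ c - (x - 1ℤ)
      shift = solve-∀
    conserved (suc k) rewrite incremented-entries xs i step k =
      shift (lookup xs k) (+ ⟨ suc c /2^ suc (toℕ k) ⟩) (+ ⟨ c /2^ suc (toℕ k) ⟩)
      where
      shift : ∀ x s c → s + x ≡ c + (x + (s - c))
      shift = solve-∀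
    parities : ∀ k → + ⟨ c /2^ suc (toℕ k) ⟩ ≡₂ a T (suc k)
    parities k = even-sum⇒≡₂ (subst Even (conserved (suc k)) (≡₂⇒even-sum (isN-parity (x ∷ xs) isN k)))

  up-run : ∀ {S S′ : State ℓ} {m} → Star IncStep S S′ → IsN S m → + suc m ≡₂ a S zero →
           ∃ λ m′ → IsN S′ m′ × m ≤ m′ × upCharge S m ≗ upCharge S′ m′
  up-run ε isN _ = _ , isN , ≤-refl , λ _ → refl
  up-run (step ◅ steps) isN heading with up-step step isN heading
  ... | isN′ , heading′ , conserved with up-run steps isN′ heading′
  ...   | m′ , isN″ , 1+m≤m′ , conserved′ =
    m′ , isN″ , <⇒≤ 1+m≤m′ , λ j → trans (conserved j) (conserved′ j)

  down-run : ∀ {S S′ : State ℓ} {m} → Star IncStep S S′ → IsN S m → + m ≡₂ a S zero →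
             ∃ λ m′ → IsN S′ m′ × m′ ≤ m × downCharge S m ≗ downCharge S′ m′
  down-run ε isN _ = _ , isN , ≤-refl , λ _ → refl
  down-run (step ◅ steps) isN heading with down-step step isN heading
  ... | c , refl , isN′ , heading′ , conserved with down-run steps isN′ heading′
  ...   | m′ , isN″ , m′≤c , conserved′ =
    m′ , isN″ , ≤-trans m′≤c (n≤1+n c) , λ j → trans (conserved j) (conserved′ j)

  EntryFormula : State ℓ → State ℓ → ℕ → ℕ → Set
  EntryFormula S S′ n n′ = (a S′ zero ≡ a S zero - d 0 (+ n) (+ n′))
                         × (∀ i → a S′ (suc i) ≡ a S (suc i) + d (suc (toℕ i)) (+ n) (+ n′))

  up-run-entries : ∀ {S S′ : State ℓ} {n n′} → Star IncStep S S′ → IsN S n → IsN S′ n′ →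
                   + suc n ≡₂ a S zero → EntryFormula S S′ n n′
  up-run-entries {S} {S′} {n} steps isN isN′ heading with up-run steps isN heading
  ... | n′ , isN-n′ , n≤n′ , conserved with isN-unique S′ isN-n′ isN′
  ...   | refl = entry₀ , entry
    where
    open ≡-Reasoning
    entry₀ : a S′ zero ≡ a S zero - d 0 (+ n) (+ n′)
    entry₀ = begin
      a S′ zero
        ≡⟨ x+u≡y+v⇒y≡x-[v-u] (a S zero) (a S′ zero) (+ n) (+ n′) (conserved zero) ⟩
      a S zero - (+ n′ - + n)
        ≡⟨ cong (λ z → a S zero - z) (d-≤ 0 n≤n′) ⟨
      a S zero - d 0 (+ n) (+ n′)
        ∎
    entry : ∀ i → a S′ (suc i) ≡ a S (suc i) + d (suc (toℕ i)) (+ n) (+ n′)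
    entry i = begin
      a S′ (suc i)
        ≡⟨ u-x≡v-y⇒y≡x+[v-u] (a S (suc i)) (a S′ (suc i)) (+ ⟨ n /2^ j ⟩) (+ ⟨ n′ /2^ j ⟩) (conserved (suc i)) ⟩
      a S (suc i) + (+ ⟨ n′ /2^ j ⟩ - + ⟨ n /2^ j ⟩)
        ≡⟨ cong (λ z → a S (suc i) + z) (d-≤ j n≤n′) ⟨
      a S (suc i) + d j (+ n) (+ n′)
        ∎
      where
      j : ℕ
      j = suc (toℕ i)

  down-run-entries : ∀ {S S′ : State ℓ} {n n′} → Star IncStep S S′ → IsN S n → IsN S′ n′ →
                     + n ≡₂ a S zero → EntryFormula S S′ n n′
  down-run-entries {S} {S′} {n} steps isN isN′ heading with down-run steps isN heading
  ... | n′ , isN-n′ , n′≤n , conserved with isN-unique S′ isN-n′ isN′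
  ...   | refl = entry₀ , entry
    where
    open ≡-Reasoning
    entry₀ : a S′ zero ≡ a S zero - d 0 (+ n) (+ n′)
    entry₀ = begin
      a S′ zero
        ≡⟨ u-x≡v-y⇒y≡x-[u-v] (a S zero) (a S′ zero) (+ n) (+ n′) (conserved zero) ⟩
      a S zero - (+ n - + n′)
        ≡⟨ cong (λ z → a S zero - z) (d-≥ 0 n′≤n) ⟨
      a S zero - d 0 (+ n) (+ n′)
        ∎
    entry : ∀ i → a S′ (suc i) ≡ a S (suc i) + d (suc (toℕ i)) (+ n) (+ n′)
    entry i = begin
      a S′ (suc i)
        ≡⟨ u+x≡v+y⇒y≡x+[u-v] (a S (suc i)) (a S′ (suc i)) (+ ⟨ n /2^ j ⟩) (+ ⟨ n′ /2^ j ⟩) (conserved (suc i)) ⟩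
      a S (suc i) + (+ ⟨ n /2^ j ⟩ - + ⟨ n′ /2^ j ⟩)
        ≡⟨ cong (λ z → a S (suc i) + z) (d-≥ j n′≤n) ⟨
      a S (suc i) + d j (+ n) (+ n′)
        ∎
      where
      j : ℕ
      j = suc (toℕ i)

proposition2p2 : ∀ (ℓ : ℕ) (S S′ : State ℓ) → Star IncStep S S′
    → (n n′ : ℕ) → IsN S n → IsN S′ n′
    → (a S′ zero ≡ a S zero - d 0 (+ n) (+ n′))
      × (∀ (i : Fin ℓ) → a S′ (suc i) ≡ a S (suc i) + d (1+ (toℕ i)) (+ n) (+ n′))
proposition2p2 ℓ S S′ steps n n′ isN isN′ with even-or-odd (+ n - a S zero)
... | inj₁ n≡₂a₀ = down-run-entries steps isN isN′ (even-diff n≡₂a₀)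
... | inj₂ n≢₂a₀ = up-run-entries steps isN isN′ (odd-diff⇒1+≡₂ {+ n} n≢₂a₀)
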